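{- Let $\mathcal D$ be the universal homogeneous $I_3$-free digraph, viewed as a structure in the language consisting of one binary relation symbol for the arrow relation. Then the complete first-order theory of $\mathcal D$ is not simple.
   Context: A digraph is a pair $(G,E)$ with $E\subseteq G\times G$ such that $(g,g)\notin E$ for all $g\in G$, and $(g,g')\in E$ implies $(g',g)\notin E$; write $g\rightarrow g'$ for $(g,g')\in E$. A digraph is $I_3$-free if every set of three distinct vertices spans at least one arrow. The universal homogeneous $I_3$-free digraph is the (unique up to isomorphism) countable $I_3$-free digraph into which every finite $I_3$-free digraph embeds as an induced substructure and in which every isomorphism between finite induced substructures extends to an automorphism (the Fraïssé limit of the class of finite $I_3$-free digraphs). -}

module Defs where

open import Data.Nat using (ℕ; suc; _+_; _≤_)
open import Data.Fin using (Fin; zero; suc; _≟_)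
open import Data.List using (List; []; _∷ʳ_; applyUpTo)
open import Data.Vec.Functional using (Vector; _++_)
open import Data.Product using (Σ; _×_; _,_)
open import Data.Sum using (_⊎_)
open import Data.Empty using (⊥)
open import Relation.Nullary using (¬_)
open import Relation.Binary.PropositionalEquality using (_≡_; _≢_)
open import Function.Bundles using (_⇔_)
open import Function.Definitions using (Injective; Surjective; Bijective)

record Str : Set₁ where
  field
    Carrier : Set
    Arr     : Carrier → Carrier → Set
open Str public

IsDigraph : (G : Set) → (G → G → Set) → Set
IsDigraph G E = (∀ g → ¬ E g g) × (∀ g g' → E g g' → ¬ E g' g)

I3-free : (G : Set) → (G → G → Set) → Set
I3-free G E = ∀ a b c → a ≢ b → a ≢ c → b ≢ c →
  (E a b ⊎ E b a) ⊎ ((E a c ⊎ E c a) ⊎ (E b c ⊎ E c b))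

record FinI3Digraph : Set₁ where
  field
    size    : ℕ
    R       : Fin size → Fin size → Set
    digraph : IsDigraph (Fin size) R
    i3free  : I3-free (Fin size) R
open FinI3Digraph public

IsEmbedding : {V : Set} (E : V → V → Set) (F : FinI3Digraph) → (Fin (size F) → V) → Set
IsEmbedding E F f = Injective _≡_ _≡_ f × (∀ i j → R F i j ⇔ E (f i) (f j))

Universal : {V : Set} → (V → V → Set) → Set₁
Universal {V} E = ∀ (F : FinI3Digraph) → Σ (Fin (size F) → V) (IsEmbedding E F)

IsAutomorphism : {V : Set} → (V → V → Set) → (V → V) → Set
IsAutomorphism E σ = Bijective _≡_ _≡_ σ × (∀ x y → E x y ⇔ E (σ x) (σ y))

-- A finite induced substructure with n enumerated elements is
-- given by an injective f : Fin n → V; an isomorphism onto another one is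
-- given by g with f i ↦ g i.
Homogeneous : {V : Set} → (V → V → Set) → Set
Homogeneous {V} E = ∀ (n : ℕ) (f g : Fin n → V) →
  Injective _≡_ _≡_ f → Injective _≡_ _≡_ g →
  (∀ i j → E (f i) (f j) ⇔ E (g i) (g j)) →
  Σ (V → V) λ σ → IsAutomorphism E σ × (∀ i → σ (f i) ≡ g i)

IsUniversalHomogeneousI3Free : (V : Set) → (V → V → Set) → Set₁
IsUniversalHomogeneousI3Free V E =
  Σ (ℕ → V) (Surjective _≡_ _≡_)          -- countable
  × IsDigraph V E × I3-free V E × Universal E × Homogeneous E

data Formula : ℕ → Set where
  arr  : ∀ {n} → Fin n → Fin n → Formula n
  eql  : ∀ {n} → Fin n → Fin n → Formula n
  neg  : ∀ {n} → Formula n → Formula n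
  conj : ∀ {n} → Formula n → Formula n → Formula n
  ex   : ∀ {n} → Formula (suc n) → Formula n

extend : ∀ {A : Set} {n} → A → (Fin n → A) → Fin (suc n) → A
extend a ρ zero    = a
extend a ρ (suc i) = ρ i

Sat : (M : Str) → ∀ {n} → Formula n → (Fin n → Carrier M) → Set
Sat M (arr i j)  ρ = Arr M (ρ i) (ρ j)
Sat M (eql i j)  ρ = ρ i ≡ ρ j
Sat M (neg φ)    ρ = ¬ Sat M φ ρ
Sat M (conj φ ψ) ρ = Sat M φ ρ × Sat M ψ ρ
Sat M (ex φ)     ρ = Σ (Carrier M) λ a → Sat M φ (extend a ρ)

Sentence : Set
Sentence = Formula 0

emptyEnv : ∀ {A : Set} → Fin 0 → A
emptyEnv ()

_≡ₑ_ : Str → Str → Set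
M ≡ₑ N = ∀ (σ : Sentence) → Sat M σ emptyEnv ⇔ Sat N σ emptyEnv

-- Tree property.
-- φ(x̄ ; ȳ) with |x̄| = m, |ȳ| = p is a Formula (m + p).
-- Parameters a_s (s ∈ ω^{<ω}) are indexed by List ℕ; the children of s are
-- s ∷ʳ i; the restriction η|j of η ∈ ω^ω is applyUpTo η j.
-- In a model M ≡ Th(D), "consistent" for a set of formulas with parameters
-- in M means finitely satisfiable in M.

HasTreePropertyIn : (M : Str) (m p : ℕ) (φ : Formula (m + p)) (k : ℕ) → Set
HasTreePropertyIn M m p φ k =
  Σ (List ℕ → Vector (Carrier M) p) λ a →
      (∀ (η : ℕ → ℕ) (n : ℕ) → Σ (Vector (Carrier M) m) λ x →
          ∀ j → j ≤ n → Sat M φ (x ++ a (applyUpTo η j)))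
    ×
      (∀ (s : List ℕ) (f : Fin k → ℕ) → Injective _≡_ _≡_ f →
          ¬ Σ (Vector (Carrier M) m) λ x → ∀ l → Sat M φ (x ++ a (s ∷ʳ f l)))

NotSimple : Str → Set₁
NotSimple M = Σ ℕ λ m → Σ ℕ λ p → Σ (Formula (m + p)) λ φ → Σ ℕ λ k →
  (2 ≤ k) × Σ Str λ N → (N ≡ₑ M) × HasTreePropertyIn N m p φ k

mkStr : (V : Set) → (V → V → Set) → Str
mkStr V E = record { Carrier = V ; Arr = E }

-- Take φ(x ; y₀ y₁) to say that x is independent of (distinct from and
-- unrelated to) both y₀ and y₁. Inside 𝒟 choose vertices v(d , l , b) for
-- depth d, label l and side b ∈ {0,1}, such that v(d , l , 0) and v(d , l′ , 1)
-- with l ≢ l′ are independent and all other pairs are adjacent; this is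
-- possible because the independences form a bipartite, hence triangle-free,
-- graph, and every countable I₃-free digraph embeds into 𝒟. The node s of the
-- tree gets the parameters (v(|s| , last s , 0) , v(|s| , last s , 1)).
-- A vertex independent of the parameters of two distinct siblings would span
-- an independent triple, while the parameters along a branch are pairwise
-- adjacent, and over any finite set of pairwise adjacent vertices the
-- extension property of 𝒟 provides a vertex independent of all of them.
module Submission where

open import Defs
open import Data.Nat using (ℕ; zero; suc; _+_; _*_; _<_; _≤_; s≤s)
import Data.Nat.Properties as ℕ
open import Data.Nat.Properties using (+-suc; +-identityʳ; <-cmp; <-irrefl; <-asym; m≤m+n; m≤n+m; ≤-refl)
import Data.Fin as Fin
open import Data.Fin using (Fin; zero; suc; toℕ; fromℕ; fromℕ<; inject₁; combine; remQuot)
open import Data.Fin.Properties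
  using (0≢1+n; suc-injective; toℕ-injective; inject₁-injective; toℕ-inject₁; toℕ-fromℕ; toℕ-fromℕ<;
         remQuot-combine; combine-remQuot)
open import Data.Fin.Relation.Unary.Top using (view; ‵fromℕ; ‵inject₁)
open import Data.List using (List; []; _∷_; _∷ʳ_; length; applyUpTo)
open import Data.List.Properties using (length-++; length-applyUpTo)
open import Data.Vec.Functional using (Vector; _++_)
open import Data.Product using (Σ; _×_; _,_; proj₁; proj₂; uncurry)
import Data.Product as Product
open import Data.Sum using (_⊎_; inj₁; inj₂; [_,_])
import Data.Sum as Sum
open import Data.Empty using (⊥; ⊥-elim)
open import Function using (_∘_; id)
open import Function.Bundles using (_⇔_; Equivalence)
open import Function.Definitions using (Injective)
open import Function.Properties.Equivalence
  using () renaming (refl to ⇔-refl; sym to ⇔-sym; trans to ⇔-trans)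
open import Relation.Binary.Definitions using (Decidable; Symmetric; Irreflexive; tri<; tri≈; tri>)
open import Relation.Binary.PropositionalEquality
  using (_≡_; _≢_; refl; sym; trans; cong; cong₂; subst; subst₂; module ≡-Reasoning)
open import Relation.Nullary using (¬_; yes; no; ¬?; _×-dec_)

open Equivalence using (to; from)

Adjacent : {G : Set} → (G → G → Set) → G → G → Set
Adjacent _⟶_ u v = u ⟶ v ⊎ v ⟶ u

Independent : {G : Set} → (G → G → Set) → G → G → Set
Independent _⟶_ u v = u ≢ v × ¬ u ⟶ v × ¬ v ⟶ u

no-independent-triple : ∀ {G} {_⟶_ : G → G → Set} → I3-free G _⟶_ → ∀ {u v w} →
  Independent _⟶_ u v → Independent _⟶_ u w → Independent _⟶_ v w → ⊥
no-independent-triple i3 {u} {v} {w} (u≢v , ¬uv , ¬vu) (u≢w , ¬uw , ¬wu) (v≢w , ¬vw , ¬wv) =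
  [ [ ¬uv , ¬vu ] , [ [ ¬uw , ¬wu ] , [ ¬vw , ¬wv ] ] ] (i3 u v w u≢v u≢w v≢w)

subdigraph : ∀ {G} {_⟶_ : G → G → Set} → IsDigraph G _⟶_ → I3-free G _⟶_ →
  ∀ {n} (f : Fin n → G) → Injective _≡_ _≡_ f → FinI3Digraph
subdigraph {_⟶_ = _⟶_} (irrefl , asym) i3 {n} f f-inj = record
  { size    = n
  ; R       = λ i j → f i ⟶ f j
  ; digraph = (λ i → irrefl (f i)) , (λ i j → asym (f i) (f j))
  ; i3free  = λ a b c a≢b a≢c b≢c → i3 (f a) (f b) (f c) (a≢b ∘ f-inj) (a≢c ∘ f-inj) (b≢c ∘ f-inj)
  }

withIsolatedVertex : (F : FinI3Digraph) → (∀ i j → i ≢ j → Adjacent (R F) i j) → FinI3Digraph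
withIsolatedVertex F adjacent = record
  { size = suc (size F) ; R = R⁺ ; digraph = irrefl⁺ , asym⁺ ; i3free = i3free⁺ }
  where
  R⁺ : Fin (suc (size F)) → Fin (suc (size F)) → Set
  R⁺ zero    _       = ⊥
  R⁺ (suc i) zero    = ⊥
  R⁺ (suc i) (suc j) = R F i j

  irrefl⁺ : ∀ i → ¬ R⁺ i i
  irrefl⁺ (suc i) = proj₁ (digraph F) i

  asym⁺ : ∀ i j → R⁺ i j → ¬ R⁺ j i
  asym⁺ (suc i) (suc j) = proj₂ (digraph F) i j

  i3free⁺ : I3-free (Fin (suc (size F))) R⁺
  i3free⁺ zero    zero    _       a≢b _   _   = ⊥-elim (a≢b refl)
  i3free⁺ zero    (suc _) zero    _   a≢c _   = ⊥-elim (a≢c refl)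
  i3free⁺ (suc _) zero    zero    _   _   b≢c = ⊥-elim (b≢c refl)
  i3free⁺ zero    (suc i) (suc j) _   _   b≢c = inj₂ (inj₂ (adjacent i j (b≢c ∘ cong suc)))
  i3free⁺ (suc i) zero    (suc j) _   a≢c _   = inj₂ (inj₁ (adjacent i j (a≢c ∘ cong suc)))
  i3free⁺ (suc i) (suc j) zero    a≢b _   _   = inj₁ (adjacent i j (a≢b ∘ cong suc))
  i3free⁺ (suc i) (suc j) (suc k) a≢b a≢c b≢c =
    i3free F i j k (a≢b ∘ cong suc) (a≢c ∘ cong suc) (b≢c ∘ cong suc)

common-finite-bound : ∀ m n → Σ ℕ λ N → Σ (Fin N) λ i → Σ (Fin N) λ j → toℕ i ≡ m × toℕ j ≡ n
common-finite-bound m n =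
  suc (m + n) , fromℕ< m<N , fromℕ< n<N , toℕ-fromℕ< m<N , toℕ-fromℕ< n<N
  where
  m<N : m < suc (m + n)
  m<N = s≤s (m≤m+n m n)
  n<N : n < suc (m + n)
  n<N = s≤s (m≤n+m n m)

OrientedComplement : (ℕ → ℕ → Set) → ℕ → ℕ → Set
OrientedComplement N m n = m < n × ¬ N m n

TriangleFree : {A : Set} → (A → A → Set) → Set
TriangleFree N = ∀ {a b c} → N a b → N a c → N b c → ⊥

module _ {N : ℕ → ℕ → Set} where

  oriented-complement-digraph : IsDigraph ℕ (OrientedComplement N)
  oriented-complement-digraph =
    (λ m (m<m , _) → <-irrefl refl m<m) , (λ m n (m<n , _) (n<m , _) → <-asym m<n n<m)

  oriented-complement-adjacent : Symmetric N → ∀ {m n} → m ≢ n → ¬ N m n → Adjacent (OrientedComplement N) m n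
  oriented-complement-adjacent N-sym {m} {n} m≢n ¬Nmn with <-cmp m n
  ... | tri< m<n _ _ = inj₁ (m<n , ¬Nmn)
  ... | tri≈ _ m≡n _ = ⊥-elim (m≢n m≡n)
  ... | tri> _ _ n<m = inj₂ (n<m , ¬Nmn ∘ N-sym)

  oriented-complement-i3free : Decidable N → Symmetric N → TriangleFree N → I3-free ℕ (OrientedComplement N)
  oriented-complement-i3free N? N-sym N-tf a b c a≢b a≢c b≢c with N? a b | N? a c | N? b c
  ... | no ¬ab | _      | _      = inj₁ (oriented-complement-adjacent N-sym a≢b ¬ab)
  ... | yes _  | no ¬ac | _      = inj₂ (inj₁ (oriented-complement-adjacent N-sym a≢c ¬ac))
  ... | yes _  | yes _  | no ¬bc = inj₂ (inj₂ (oriented-complement-adjacent N-sym b≢c ¬bc))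
  ... | yes ab | yes ac | yes bc = ⊥-elim (N-tf ab ac bc)

record Enumeration (A : Set) : Set where
  field
    decode        : ℕ → A
    encode        : A → ℕ
    decode-encode : ∀ a → decode (encode a) ≡ a

  encode-injective : Injective _≡_ _≡_ encode
  encode-injective {a} {b} eq = trans (sym (decode-encode a)) (trans (cong decode eq) (decode-encode b))

open Enumeration

-- Cantor's enumeration of ℕ × ℕ: walk each antidiagonal from (s , 0) to (0 , s).
next : ℕ × ℕ → ℕ × ℕ
next (zero  , j) = suc j , zero
next (suc i , j) = i , suc j

unpair : ℕ → ℕ × ℕ
unpair zero    = 0 , 0
unpair (suc n) = next (unpair n)

unpair-along-antidiagonal : ∀ j i k n → unpair n ≡ (i + j , k) → unpair (j + n) ≡ (i , k + j)
unpair-along-antidiagonal zero i k n eq rewrite +-identityʳ i | +-identityʳ k = eq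
unpair-along-antidiagonal (suc j) i k n eq rewrite +-suc k j =
  cong next (unpair-along-antidiagonal j (suc i) k n (trans eq (cong (_, k) (+-suc i j))))

unpair-reaches-axis : ∀ s → Σ ℕ λ n → unpair n ≡ (s , 0)
unpair-reaches-axis zero = 0 , refl
unpair-reaches-axis (suc s) with unpair-reaches-axis s
... | n , eq = suc (s + n) , cong next (unpair-along-antidiagonal s 0 0 n eq)

unpair-surjective : ∀ p → Σ ℕ λ n → unpair n ≡ p
unpair-surjective (i , j) with unpair-reaches-axis (i + j)
... | n , eq = j + n , unpair-along-antidiagonal j i 0 n eq

ℕ-enumeration : Enumeration ℕ
ℕ-enumeration = record { decode = id ; encode = id ; decode-encode = λ _ → refl }

Fin2-enumeration : Enumeration (Fin 2)
Fin2-enumeration = record { decode = decode₂ ; encode = toℕ ; decode-encode = decode₂-toℕ }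
  where
  decode₂ : ℕ → Fin 2
  decode₂ zero    = zero
  decode₂ (suc _) = suc zero

  decode₂-toℕ : ∀ b → decode₂ (toℕ b) ≡ b
  decode₂-toℕ zero       = refl
  decode₂-toℕ (suc zero) = refl

×-enumeration : ∀ {A B} → Enumeration A → Enumeration B → Enumeration (A × B)
×-enumeration EA EB = record
  { decode        = Product.map (decode EA) (decode EB) ∘ unpair
  ; encode        = λ (a , b) → proj₁ (unpair-surjective (encode EA a , encode EB b))
  ; decode-encode = λ (a , b) →
      trans (cong (Product.map (decode EA) (decode EB)) (proj₂ (unpair-surjective (encode EA a , encode EB b))))
            (cong₂ _,_ (decode-encode EA a) (decode-encode EB b))
  }

length-applyUpTo-injective : ∀ (η : ℕ → ℕ) {i j} → length (applyUpTo η i) ≡ length (applyUpTo η j) → i ≡ j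
length-applyUpTo-injective η {i} {j} eq = trans (sym (length-applyUpTo η i)) (trans eq (length-applyUpTo η j))

remQuot-injective : ∀ {m} k → Injective _≡_ _≡_ (remQuot {m} k)
remQuot-injective {m} k {i} {j} eq =
  trans (sym (combine-remQuot {m} k i)) (trans (cong (uncurry combine) eq) (combine-remQuot {m} k j))

Index : Set
Index = ℕ × ℕ × Fin 2

index-enumeration : Enumeration Index
index-enumeration = ×-enumeration ℕ-enumeration (×-enumeration ℕ-enumeration Fin2-enumeration)

Crossing : Index → Index → Set
Crossing (d , l , b) (d′ , l′ , b′) = d ≡ d′ × l ≢ l′ × b ≢ b′

crossing? : Decidable Crossing
crossing? (d , l , b) (d′ , l′ , b′) = d ℕ.≟ d′ ×-dec ¬? (l ℕ.≟ l′) ×-dec ¬? (b Fin.≟ b′)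

crossing-symmetric : Symmetric Crossing
crossing-symmetric (d≡d′ , l≢l′ , b≢b′) = sym d≡d′ , l≢l′ ∘ sym , b≢b′ ∘ sym

crossing-irreflexive : Irreflexive _≡_ Crossing
crossing-irreflexive refl (_ , l≢l , _) = l≢l refl

no-three-distinct-Fin2 : (a b c : Fin 2) → a ≢ b → a ≢ c → b ≢ c → ⊥
no-three-distinct-Fin2 zero       zero       _          a≢b _   _   = a≢b refl
no-three-distinct-Fin2 zero       (suc zero) zero       _   a≢c _   = a≢c refl
no-three-distinct-Fin2 zero       (suc zero) (suc zero) _   _   b≢c = b≢c refl
no-three-distinct-Fin2 (suc zero) zero       zero       _   _   b≢c = b≢c refl
no-three-distinct-Fin2 (suc zero) zero       (suc zero) _   a≢c _   = a≢c refl
no-three-distinct-Fin2 (suc zero) (suc zero) _          a≢b _   _   = a≢b refl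

crossing-triangle-free : TriangleFree Crossing
crossing-triangle-free (_ , _ , b≢b′) (_ , _ , b≢b″) (_ , _ , b′≢b″) =
  no-three-distinct-Fin2 _ _ _ b≢b′ b≢b″ b′≢b″

lastOr : ℕ → List ℕ → ℕ
lastOr d []       = d
lastOr _ (x ∷ xs) = lastOr x xs

lastOr-∷ʳ : ∀ d s k → lastOr d (s ∷ʳ k) ≡ k
lastOr-∷ʳ d []      k = refl
lastOr-∷ʳ d (x ∷ s) k = lastOr-∷ʳ x s k

nodeIndex : List ℕ → Fin 2 → Index
nodeIndex s b = length s , lastOr 0 s , b

siblings-crossing : ∀ s {i j} → i ≢ j → Crossing (nodeIndex (s ∷ʳ i) zero) (nodeIndex (s ∷ʳ j) (suc zero))
siblings-crossing s {i} {j} i≢j =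
  trans (length-++ s) (sym (length-++ s)) ,
  (λ eq → i≢j (trans (sym (lastOr-∷ʳ 0 s i)) (trans eq (lastOr-∷ʳ 0 s j)))) ,
  0≢1+n

branchPoint : (η : ℕ → ℕ) {n : ℕ} → Fin n × Fin 2 → Index
branchPoint η (j , b) = nodeIndex (applyUpTo η (toℕ j)) b

branchPoint-injective : ∀ η {n} → Injective _≡_ _≡_ (branchPoint η {n})
branchPoint-injective η eq =
  cong₂ _,_ (toℕ-injective (length-applyUpTo-injective η (cong proj₁ eq))) (cong (proj₂ ∘ proj₂) eq)

branchPoint-not-crossing : ∀ η {n} (p q : Fin n × Fin 2) → ¬ Crossing (branchPoint η p) (branchPoint η q)
branchPoint-not-crossing η (j , _) (j′ , _) (depths≡ , l≢l′ , _) =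
  l≢l′ (cong (lastOr 0 ∘ applyUpTo η) (length-applyUpTo-injective η {toℕ j} {toℕ j′} depths≡))

independentF : ∀ {n} → Fin n → Fin n → Formula n
independentF i j = conj (neg (eql i j)) (conj (neg (arr i j)) (neg (arr j i)))

independent-of-pair : Formula (1 + 2)
independent-of-pair = conj (independentF zero (suc zero)) (independentF zero (suc (suc zero)))

module UniversalHomogeneous {V : Set} {E : V → V → Set} (E-digraph : IsDigraph V E) (E-i3free : I3-free V E)
         (universal : Universal E) (homogeneous : Homogeneous E) where

  -- Universality places a copy of F in V; homogeneity then moves the copy so that it agrees with f on h.
  extend-embedding : (F : FinI3Digraph) {n : ℕ} (h : Fin n → Fin (size F)) → Injective _≡_ _≡_ h →
    (f : Fin n → V) → Injective _≡_ _≡_ f → (∀ i j → R F (h i) (h j) ⇔ E (f i) (f j)) →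
    Σ (Fin (size F) → V) λ e → IsEmbedding E F e × (∀ i → e (h i) ≡ f i)
  extend-embedding F h h-inj f f-inj h∼f with universal F
  ... | g , g-inj , g-rel
    with homogeneous _ (g ∘ h) f (h-inj ∘ g-inj) f-inj
                     (λ i j → ⇔-trans (⇔-sym (g-rel (h i) (h j))) (h∼f i j))
  ... | σ , ((σ-inj , _) , σ-rel) , σgh≡f =
    σ ∘ g , (g-inj ∘ σ-inj , λ i j → ⇔-trans (g-rel i j) (σ-rel (g i) (g j))) , σgh≡f

  independent-of-clique : ∀ {m} (f : Fin m → V) → Injective _≡_ _≡_ f →
    (∀ k l → k ≢ l → Adjacent E (f k) (f l)) → Σ V λ x → ∀ k → Independent E x (f k)
  independent-of-clique f f-inj f-adjacent
    with extend-embedding (withIsolatedVertex (subdigraph E-digraph E-i3free f f-inj) f-adjacent)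
                          suc suc-injective f f-inj (λ _ _ → ⇔-refl)
  ... | e , (e-inj , e-rel) , e-extends = e zero , λ k →
    subst (Independent E (e zero)) (e-extends k)
      ((λ p → 0≢1+n (e-inj p)) , from (e-rel zero (suc k)) , from (e-rel (suc k) zero))

  -- The embedding is the union of a chain of embeddings of the initial segments, each obtained from
  -- the previous one by the extension property.
  module ℕ-Embedding {T : ℕ → ℕ → Set} (T-digraph : IsDigraph ℕ T) (T-i3free : I3-free ℕ T) where

    private
      segment : ℕ → FinI3Digraph
      segment n = subdigraph T-digraph T-i3free (toℕ {n}) toℕ-injective

      Stage : ℕ → Set
      Stage n = Σ (Fin n → V) (IsEmbedding E (segment n))

      inject₁-related : ∀ {n} ((f , _) : Stage n) i j →
        R (segment (suc n)) (inject₁ i) (inject₁ j) ⇔ E (f i) (f j)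
      inject₁-related (_ , _ , f-rel) i j rewrite toℕ-inject₁ i | toℕ-inject₁ j = f-rel i j

      grow : ∀ n (s : Stage n) → Σ (Stage (suc n)) λ s′ → ∀ i → proj₁ s′ (inject₁ i) ≡ proj₁ s i
      grow n s@(f , f-inj , _)
        with extend-embedding (segment (suc n)) inject₁ inject₁-injective f f-inj (inject₁-related s)
      ... | e , e-emb , e-extends = (e , e-emb) , e-extends

      stage : ∀ n → Stage n
      stage zero    = (λ ()) , (λ { {()} }) , λ ()
      stage (suc n) = proj₁ (grow n (stage n))

    embed : ℕ → V
    embed n = proj₁ (stage (suc n)) (fromℕ n)

    private
      stage-agrees : ∀ n (i : Fin n) → proj₁ (stage n) i ≡ embed (toℕ i)
      stage-agrees (suc n) i with view i
      ... | ‵fromℕ     = cong embed (sym (toℕ-fromℕ n))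
      ... | ‵inject₁ j = begin
        proj₁ (stage (suc n)) (inject₁ j) ≡⟨ proj₂ (grow n (stage n)) j ⟩
        proj₁ (stage n) j                 ≡⟨ stage-agrees n j ⟩
        embed (toℕ j)                     ≡⟨ cong embed (sym (toℕ-inject₁ j)) ⟩
        embed (toℕ (inject₁ j))           ∎
        where open ≡-Reasoning

    embed-injective : Injective _≡_ _≡_ embed
    embed-injective {m} {n} eq with common-finite-bound m n
    ... | N , i , j , refl , refl =
      cong toℕ (proj₁ (proj₂ (stage N)) (trans (stage-agrees N i) (trans eq (sym (stage-agrees N j)))))

    embed-related : ∀ m n → T m n ⇔ E (embed m) (embed n)
    embed-related m n with common-finite-bound m n
    ... | N , i , j , refl , refl =
      subst₂ (λ x y → T (toℕ i) (toℕ j) ⇔ E x y) (stage-agrees N i) (stage-agrees N j)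
             (proj₂ (proj₂ (stage N)) i j)

  record Realizes {A : Set} (N : A → A → Set) (v : A → V) : Set where
    field
      injective   : Injective _≡_ _≡_ v
      independent : ∀ a b → N a b → Independent E (v a) (v b)
      adjacent    : ∀ a b → a ≢ b → ¬ N a b → Adjacent E (v a) (v b)

  realize : ∀ {A} → Enumeration A → (N : A → A → Set) → Decidable N → Symmetric N → Irreflexive _≡_ N →
    TriangleFree N → Σ (A → V) (Realizes N)
  realize {A} EA N N? N-sym N-irrefl N-tf =
    v , record { injective = v-inj ; independent = v-independent ; adjacent = v-adjacent }
    where
    N′ : ℕ → ℕ → Set
    N′ m n = N (decode EA m) (decode EA n)

    open ℕ-Embedding {OrientedComplement N′} oriented-complement-digraph
      (oriented-complement-i3free (λ m n → N? _ _) N-sym N-tf)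

    v : A → V
    v = embed ∘ encode EA

    v-inj : Injective _≡_ _≡_ v
    v-inj = encode-injective EA ∘ embed-injective

    N′-encode : ∀ {a b} → N′ (encode EA a) (encode EA b) ≡ N a b
    N′-encode {a} {b} = cong₂ N (decode-encode EA a) (decode-encode EA b)

    unrelated : ∀ a b → N a b → ¬ E (v a) (v b)
    unrelated a b Nab Evab = proj₂ (from (embed-related _ _) Evab) (subst id (sym N′-encode) Nab)

    v-independent : ∀ a b → N a b → Independent E (v a) (v b)
    v-independent a b Nab =
      (λ va≡vb → N-irrefl (v-inj va≡vb) Nab) , unrelated a b Nab , unrelated b a (N-sym Nab)

    v-adjacent : ∀ a b → a ≢ b → ¬ N a b → Adjacent E (v a) (v b)
    v-adjacent a b a≢b ¬Nab =
      Sum.map (to (embed-related _ _)) (to (embed-related _ _))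
        (oriented-complement-adjacent {N′} N-sym (λ p → a≢b (encode-injective EA p))
                                                 (¬Nab ∘ subst id N′-encode))

  module TreeParameters (v : Index → V) (v-realizes : Realizes Crossing v) where
    open Realizes v-realizes

    parameters : List ℕ → Vector V 2
    parameters s b = v (nodeIndex s b)

    siblings-inconsistent : ∀ s (f : Fin 2 → ℕ) → Injective _≡_ _≡_ f →
      ¬ Σ (Vector V 1) λ x → ∀ l → Sat (mkStr V E) independent-of-pair (x ++ parameters (s ∷ʳ f l))
    siblings-inconsistent s f f-inj (x , sat) =
      no-independent-triple E-i3free (proj₁ (sat zero)) (proj₂ (sat (suc zero)))
        (independent _ _ (siblings-crossing s (0≢1+n ∘ f-inj)))

    branchVertex : (η : ℕ → ℕ) (n : ℕ) → Fin (n * 2) → V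
    branchVertex η n = v ∘ branchPoint η ∘ remQuot {n} 2

    branchVertex-injective : ∀ η n → Injective _≡_ _≡_ (branchVertex η n)
    branchVertex-injective η n eq = remQuot-injective {n} 2 (branchPoint-injective η (injective eq))

    branchVertex-adjacent : ∀ η n k l → k ≢ l → Adjacent E (branchVertex η n k) (branchVertex η n l)
    branchVertex-adjacent η n k l k≢l =
      adjacent _ _ (λ eq → k≢l (remQuot-injective {n} 2 (branchPoint-injective η eq)))
                   (branchPoint-not-crossing η (remQuot {n} 2 k) (remQuot 2 l))

    branchVertex-combine : ∀ η {n j} (j<n : j < n) b →
      branchVertex η n (combine (fromℕ< j<n) b) ≡ parameters (applyUpTo η j) b
    branchVertex-combine η {n} j<n b = cong v (trans
      (cong (branchPoint η) (remQuot-combine (fromℕ< j<n) b))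
      (cong (λ k → nodeIndex (applyUpTo η k) b) (toℕ-fromℕ< {n = n} j<n)))

    branch-consistent : ∀ η n → Σ (Vector V 1) λ x →
      ∀ j → j ≤ n → Sat (mkStr V E) independent-of-pair (x ++ parameters (applyUpTo η j))
    branch-consistent η n
      with independent-of-clique (branchVertex η (suc n)) (branchVertex-injective η (suc n))
                                 (branchVertex-adjacent η (suc n))
    ... | x , x-independent =
      (λ _ → x) , λ j j≤n → independent-at (s≤s j≤n) zero , independent-at (s≤s j≤n) (suc zero)
      where
      independent-at : ∀ {j} (j<1+n : j < suc n) b → Independent E x (parameters (applyUpTo η j) b)
      independent-at j<1+n b =
        subst (Independent E x) (branchVertex-combine η j<1+n b) (x-independent (combine (fromℕ< j<1+n) b))

    tree-property : HasTreePropertyIn (mkStr V E) 1 2 independent-of-pair 2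
    tree-property = parameters , branch-consistent , siblings-inconsistent

  independent-of-pair-tree-property : HasTreePropertyIn (mkStr V E) 1 2 independent-of-pair 2
  independent-of-pair-tree-property
    with realize index-enumeration Crossing crossing? crossing-symmetric crossing-irreflexive crossing-triangle-free
  ... | v , v-realizes = TreeParameters.tree-property v v-realizes

mainTheorem3 : (V : Set) (E : V → V → Set) → IsUniversalHomogeneousI3Free V E →
    NotSimple (mkStr V E)
mainTheorem3 V E (_ , E-digraph , E-i3free , universal , homogeneous) =
  1 , 2 , independent-of-pair , 2 , ≤-refl , mkStr V E , (λ _ → ⇔-refl) ,
  UniversalHomogeneous.independent-of-pair-tree-property E-digraph E-i3free universal homogeneous
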